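{- Let $\mathfrak{D} = \langle \mathfrak{M}, \star\rangle$ be a class of dynamic models. The following axiom schema is valid in $\mathfrak{D}$ for any $\varphi \in \mathcal{L}_0$ and $\xi \in \mathcal{L}_\leq(\star)$ iff $\star$ is $\mathfrak{M}$-DP4-compliant: $$ {}[\star \varphi][\leq](\varphi \rightarrow \xi) \rightarrow (\neg \varphi \rightarrow [\leq] [\star \varphi] (\varphi\rightarrow \xi))$$
   Context: Fix a set $P$ of propositional letters; $\mathcal{L}_0$ is the classical propositional language over $P$. A (well-founded) preference model is $M=\langle W,\leq,v\rangle$ with $W$ a set of worlds, $\leq$ a reflexive, transitive relation on $W$ whose strict part $<$ is well-founded, and $v:P\to 2^W$ a valuation; $\mathit{Mod}(\mathcal{L}_\leq)$ is the class of all such models. A dynamic operator is a map $\star:\mathit{Mod}(\mathcal{L}_\leq)\times\mathcal{L}_0\to\mathit{Mod}(\mathcal{L}_\leq)$ with $\star(M,\varphi)=\langle W,\leq_{\star\varphi},v\rangle$ (same worlds and valuation). The language $\mathcal{L}_\leq(\star)$ is built from $P$ with $\neg,\wedge$, the universal modality $A$, the modalities $[\leq]$, $[<]$, and formulas $[\star\varphi]\xi$ with $\varphi\in\mathcal{L}_0$. A dynamic model is $D=\langle M,\star\rangle$, with $D,w\vDash A\xi$ iff every world satisfies $\xi$, $D,w\vDash[\leq]\xi$ iff every $w'\leq w$ satisfies $\xi$, $D,w\vDash[<]\xi$ iff every $w'<w$ satisfies $\xi$, and $D,w\vDash[\star\varphi]\xi$ iff $\langle\star(M,\varphi),\star\rangle,w\vDash\xi$.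 For a class $\mathfrak{M}$ of preference models over which $\star$ is closed, $\mathfrak{D}=\langle\mathfrak{M},\star\rangle$ is the class of dynamic models $\langle M,\star\rangle$ with $M\in\mathfrak{M}$; a formula is valid in $\mathfrak{D}$ if it is true at every world of every such model. $[\![\varphi]\!]$ denotes the set of worlds of the model under consideration satisfying $\varphi$. $\star$ is $\mathfrak{M}$-DP4-compliant if for every $M=\langle W,\leq,v\rangle\in\mathfrak{M}$, every $\varphi\in\mathcal{L}_0$ and all $w,w'\in W$, with $D=\langle M,\star\rangle$: (DP4a) if $w\in[\![\varphi]\!]$, $w'\notin[\![\varphi]\!]$ and $w\leq w'$, then for every $\xi\in\mathcal{L}_\leq(\star)$ with $D,w\vDash[\star\varphi]\xi$ there is $w''\in[\![\varphi]\!]$ with $D,w''\vDash[\star\varphi]\xi$ and $w''\leq_{\star\varphi}w'$. -}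

module Defs where

open import Level using (0ℓ)
open import Data.Product using (Σ; _×_; ∃; ∃-syntax)
open import Data.Empty using (⊥)
open import Relation.Nullary using (¬_)
open import Relation.Binary.PropositionalEquality using (_≡_)
open import Relation.Binary.Structures using (IsPreorder)
open import Induction.WellFounded using (WellFounded)

data Form₀ (P : Set) : Set where
  atom : P → Form₀ P
  ¬₀_  : Form₀ P → Form₀ P
  _∧₀_ : Form₀ P → Form₀ P → Form₀ P

data Form (P : Set) : Set where
  atom  : P → Form P
  ¬'_   : Form P → Form P
  _∧'_  : Form P → Form P → Form P
  𝐀     : Form P → Form P
  [≤]   : Form P → Form P
  [<]   : Form P → Form P
  [⋆_]_ : Form₀ P → Form P → Form P

_⇒'_ : {P : Set} → Form P → Form P → Form P
φ ⇒' ξ = ¬' (φ ∧' (¬' ξ))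

embed : {P : Set} → Form₀ P → Form P
embed (atom p) = atom p
embed (¬₀ φ)   = ¬' embed φ
embed (φ ∧₀ ψ) = embed φ ∧' embed ψ

record PrefOrder (W : Set) : Set₁ where
  field
    _≤_        : W → W → Set
    isPreorder : IsPreorder _≡_ _≤_

  _<_ : W → W → Set
  w < w' = (w ≤ w') × ¬ (w' ≤ w)

  field
    wf : WellFounded _<_

record Model (P : Set) : Set₁ where
  field
    W   : Set
    ord : PrefOrder W
    v   : P → W → Set
  open PrefOrder ord public

-- A dynamic operator: given a model and φ ∈ L₀, a new preference order on the
-- same worlds (same valuation, by construction of `update`).
DynOp : Set → Set₁
DynOp P = (M : Model P) → Form₀ P → PrefOrder (Model.W M)

update : {P : Set} → DynOp P → (M : Model P) → Form₀ P → Model P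
update ⋆ M φ = record { W = Model.W M ; ord = ⋆ M φ ; v = Model.v M }

sat : {P : Set} → DynOp P → (M : Model P) → Model.W M → Form P → Set
sat ⋆ M w (atom p)   = Model.v M p w
sat ⋆ M w (¬' ξ)     = ¬ sat ⋆ M w ξ
sat ⋆ M w (ξ ∧' χ)   = sat ⋆ M w ξ × sat ⋆ M w χ
sat ⋆ M w (𝐀 ξ)      = ∀ w' → sat ⋆ M w' ξ
sat ⋆ M w ([≤] ξ)    = ∀ w' → Model._≤_ M w' w → sat ⋆ M w' ξ
sat ⋆ M w ([<] ξ)    = ∀ w' → Model._<_ M w' w → sat ⋆ M w' ξ
sat ⋆ M w ([⋆ φ ] ξ) = sat ⋆ (update ⋆ M φ) w ξ

ModelClass : Set → Set₁
ModelClass P = Model P → Set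

ClosedUnder : {P : Set} → ModelClass P → DynOp P → Set₁
ClosedUnder 𝔐 ⋆ = ∀ M φ → 𝔐 M → 𝔐 (update ⋆ M φ)

ValidIn : {P : Set} → ModelClass P → DynOp P → Form P → Set₁
ValidIn 𝔐 ⋆ χ = ∀ M → 𝔐 M → ∀ w → sat ⋆ M w χ

DP4-compliant : {P : Set} → ModelClass P → DynOp P → Set₁
DP4-compliant {P} 𝔐 ⋆ =
  ∀ (M : Model P) → 𝔐 M → ∀ (φ : Form₀ P) (w w' : Model.W M) →
  sat ⋆ M w (embed φ) → ¬ sat ⋆ M w' (embed φ) → Model._≤_ M w w' →
  ∀ (ξ : Form P) → sat ⋆ M w ([⋆ φ ] ξ) →
  ∃[ w'' ] (sat ⋆ M w'' (embed φ) × sat ⋆ M w'' ([⋆ φ ] ξ)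
            × PrefOrder._≤_ (⋆ M φ) w'' w')

DP4-axiom : {P : Set} → Form₀ P → Form P → Form P
DP4-axiom φ ξ =
  ([⋆ φ ] [≤] (embed φ ⇒' ξ)) ⇒' ((¬' embed φ) ⇒' [≤] ([⋆ φ ] (embed φ ⇒' ξ)))

-- Read contrapositively at a ¬φ-world w', the instance of the axiom for ¬ξ is
-- exactly DP4a for ξ: a φ-world w ≤ w' satisfying [⋆φ]ξ forces a φ-world
-- w'' ≤⋆φ w' satisfying [⋆φ]ξ.  Constructively the axiom only refutes the
-- absence of such a w'', so excluded middle is needed in that direction.
-- Truth of L₀-formulas does not depend on the order, so φ can be read in M or
-- in ⋆(M, φ) alike.
module Submission where

open import Defs
open import Level using (0ℓ)
open import Axiom.ExcludedMiddle using (ExcludedMiddle)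
open import Axiom.DoubleNegationElimination using (em⇒dne)
open import Function.Base using (id)
open import Function.Bundles using (_⇔_; mk⇔)
open import Data.Product using (_×_; _,_; ∃-syntax)
open import Relation.Nullary using (¬_)
open import Relation.Binary.PropositionalEquality using (_≡_; refl; cong; cong₂; subst; sym)

sat-embed-update : {P : Set} (⋆ : DynOp P) (M : Model P) (χ : Form₀ P) (w : Model.W M) (ψ : Form₀ P) →
  sat ⋆ (update ⋆ M χ) w (embed ψ) ≡ sat ⋆ M w (embed ψ)
sat-embed-update ⋆ M χ w (atom p) = refl
sat-embed-update ⋆ M χ w (¬₀ ψ)   = cong ¬_ (sat-embed-update ⋆ M χ w ψ)
sat-embed-update ⋆ M χ w (ψ ∧₀ ψ') =
  cong₂ _×_ (sat-embed-update ⋆ M χ w ψ) (sat-embed-update ⋆ M χ w ψ')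

module _ {P : Set} (⋆ : DynOp P) (M : Model P) (φ : Form₀ P) where
  open Model M using (W; _≤_)

  DP4-witness : Form P → W → Set
  DP4-witness ξ w' =
    ∃[ w'' ] (sat ⋆ M w'' (embed φ) × sat ⋆ M w'' ([⋆ φ ] ξ) × PrefOrder._≤_ (⋆ M φ) w'' w')

  private
    embed-from-update : ∀ w → sat ⋆ (update ⋆ M φ) w (embed φ) → sat ⋆ M w (embed φ)
    embed-from-update w = subst id (sat-embed-update ⋆ M φ w φ)

    embed-to-update : ∀ w → sat ⋆ M w (embed φ) → sat ⋆ (update ⋆ M φ) w (embed φ)
    embed-to-update w = subst id (sym (sat-embed-update ⋆ M φ w φ))

  DP4-axiom-holds : ∀ ξ w' →
    (∀ w → sat ⋆ M w (embed φ) → ¬ sat ⋆ M w' (embed φ) → w ≤ w' →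
       sat ⋆ M w ([⋆ φ ] (¬' ξ)) → DP4-witness (¬' ξ) w') →
    sat ⋆ M w' (DP4-axiom φ ξ)
  DP4-axiom-holds ξ w' dp4a (premise , ¬consequent) =
    ¬consequent λ (¬φw' , ¬[≤]) → ¬[≤] λ w w≤w' (φw , ¬ξ) →
      let (w'' , φw'' , ¬ξw'' , w''≤⋆w') = dp4a w (embed-from-update w φw) ¬φw' w≤w' ¬ξ
      in premise w'' w''≤⋆w' (embed-to-update w'' φw'' , ¬ξw'')

  DP4-axiom⇒¬¬witness : ∀ ξ w w' → sat ⋆ M w' (DP4-axiom φ (¬' ξ)) →
    sat ⋆ M w (embed φ) → ¬ sat ⋆ M w' (embed φ) → w ≤ w' →
    sat ⋆ M w ([⋆ φ ] ξ) → ¬ ¬ DP4-witness ξ w'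
  DP4-axiom⇒¬¬witness ξ w w' axiom φw ¬φw' w≤w' ξw ¬witness = axiom (premise , consequent)
    where
    premise : sat ⋆ M w' ([⋆ φ ] [≤] (embed φ ⇒' (¬' ξ)))
    premise w'' w''≤⋆w' (φw'' , ¬¬ξw'') = ¬¬ξw'' λ ξw'' →
      ¬witness (w'' , embed-from-update w'' φw'' , ξw'' , w''≤⋆w')

    consequent : ¬ sat ⋆ M w' ((¬' embed φ) ⇒' [≤] ([⋆ φ ] (embed φ ⇒' (¬' ξ))))
    consequent ¬implication = ¬implication (¬φw' , λ ¬[≤] →
      ¬[≤] w w≤w' (embed-to-update w φw , λ ¬ξw → ¬ξw ξw))

proposition36 : ExcludedMiddle 0ℓ → {P : Set} (𝔐 : ModelClass P) (⋆ : DynOp P) →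
    ClosedUnder 𝔐 ⋆ →
    ((∀ (φ : Form₀ P) (ξ : Form P) → ValidIn 𝔐 ⋆ (DP4-axiom φ ξ)) ⇔ DP4-compliant 𝔐 ⋆)
proposition36 em 𝔐 ⋆ _ = mk⇔ valid⇒compliant compliant⇒valid
  where
  valid⇒compliant : (∀ φ ξ → ValidIn 𝔐 ⋆ (DP4-axiom φ ξ)) → DP4-compliant 𝔐 ⋆
  valid⇒compliant valid M M∈𝔐 φ w w' φw ¬φw' w≤w' ξ ξw =
    em⇒dne em (DP4-axiom⇒¬¬witness ⋆ M φ ξ w w' (valid φ (¬' ξ) M M∈𝔐 w') φw ¬φw' w≤w' ξw)

  compliant⇒valid : DP4-compliant 𝔐 ⋆ → ∀ φ ξ → ValidIn 𝔐 ⋆ (DP4-axiom φ ξ)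
  compliant⇒valid compliant φ ξ M M∈𝔐 w' =
    DP4-axiom-holds ⋆ M φ ξ w' λ w φw ¬φw' w≤w' → compliant M M∈𝔐 φ w w' φw ¬φw' w≤w' (¬' ξ)
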